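{- Let $H=(V,E)$ be a 3-uniform hypergraph in which every vertex has even degree, and let $G$ be its incidence graph. The following are equivalent: (1) $H$ is quasi-eulerian; (2) $G$ has a subgraph $G''$ in which every $v\in V$ has even degree and every $e\in E$ has degree exactly 1; (3) $E$ can be partitioned into pairs $\{e,e'\}$ such that $e\cap e'\neq\emptyset$.
   Context: A hypergraph $H=(V,E)$ has a nonempty finite vertex set $V$ and a finite set $E$ of edges, each associated with a subset of $V$ (parallel edges allowed); 3-uniform means every edge has exactly 3 vertices; the degree of a vertex is the number of edges containing it. The incidence graph $G$ has vertex set $V\cup E$ and an edge $ve$ whenever $v\in e$. A walk is $v_0e_1v_1\dots e_kv_k$ with $v_{i-1}\ne v_i$, $v_{i-1},v_i\in e_i$; anchors $v_0,\dots,v_k$; closed if $k\ge2$ and $v_0=v_k$; a strict trail if $e_1,\dots,e_k$ are pairwise distinct. An Euler family is a family of pairwise anchor-disjoint closed strict trails such that each edge lies in exactly one of them; $H$ is quasi-eulerian if it admits one. -}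

module Defs where

open import Data.Nat using (ℕ; suc; _≤_)
open import Data.Nat.Divisibility using (_∣_)
open import Data.Fin using (Fin; zero; suc; inject₁; fromℕ)
open import Data.Fin.Subset using (Subset; _∈_; ∣_∣; _∩_; _⊆_; Nonempty)
open import Data.Vec using (tabulate; lookup)
open import Data.Product using (Σ; ∃; ∃!; _×_)
open import Data.Sum using (_⊎_)
open import Relation.Binary.PropositionalEquality using (_≡_; _≢_)

-- A finite hypergraph: vertex set Fin nV, edge set Fin nE (edges are indices,
-- so parallel edges are allowed), each edge associated with a subset of V.
record Hypergraph : Set where
  field
    nV  : ℕ
    nE  : ℕ
    inc : Fin nE → Subset nV

module _ (H : Hypergraph) where
  open Hypergraph H

  V : Set
  V = Fin nV

  E : Set
  E = Fin nE

  ThreeUniform : Set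
  ThreeUniform = ∀ (e : E) → ∣ inc e ∣ ≡ 3

  edgesAt : V → Subset nE
  edgesAt v = tabulate (λ e → lookup (inc e) v)

  degree : V → ℕ
  degree v = ∣ edgesAt v ∣

  EvenDegrees : Set
  EvenDegrees = ∀ (v : V) → 2 ∣ degree v

  -- A closed strict trail v₀ e₁ v₁ … e_k v_k : anchors are anchor 0 … anchor k,
  -- edges e_{i+1} = edge i (i : Fin k).
  record ClosedStrictTrail : Set where
    field
      len      : ℕ
      anchor   : Fin (suc len) → V
      edge     : Fin len → E
      len≥2    : 2 ≤ len
      distinct : ∀ (i : Fin len) → anchor (inject₁ i) ≢ anchor (suc i)
      inEdge   : ∀ (i : Fin len) →
                   (anchor (inject₁ i) ∈ inc (edge i)) × (anchor (suc i) ∈ inc (edge i))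
      closed   : anchor zero ≡ anchor (fromℕ len)
      strict   : ∀ (i j : Fin len) → edge i ≡ edge j → i ≡ j

  open ClosedStrictTrail

  AnchorDisjoint : ClosedStrictTrail → ClosedStrictTrail → Set
  AnchorDisjoint T T' = ∀ i j → anchor T i ≢ anchor T' j

  EdgeOf : E → ClosedStrictTrail → Set
  EdgeOf e T = ∃ λ i → edge T i ≡ e

  record EulerFamily : Set where
    field
      size     : ℕ
      trail    : Fin size → ClosedStrictTrail
      disjoint : ∀ (s t : Fin size) → s ≢ t → AnchorDisjoint (trail s) (trail t)
      cover    : ∀ (e : E) → ∃! _≡_ (λ t → EdgeOf e (trail t))

  QuasiEulerian : Set
  QuasiEulerian = EulerFamily

  -- (2) A subgraph G'' of the incidence graph G (vertex set V ∪ E, v ~ e iff v ∈ e),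
  -- given by its edge set: sel e ⊆ inc e is the set of v with ve an edge of G''.
  record EvenOneSubgraph : Set where
    field
      sel    : E → Subset nV
      sub    : ∀ (e : E) → sel e ⊆ inc e
      degE   : ∀ (e : E) → ∣ sel e ∣ ≡ 1
      degV   : ∀ (v : V) → 2 ∣ ∣ tabulate (λ e → lookup (sel e) v) ∣

  record IntersectingPairPartition : Set where
    field
      size      : ℕ
      fst snd   : Fin size → E
      pairDiff  : ∀ (t : Fin size) → fst t ≢ snd t
      meet      : ∀ (t : Fin size) → Nonempty (inc (fst t) ∩ inc (snd t))
      partition : ∀ (e : E) → ∃! _≡_ (λ t → (fst t ≡ e) ⊎ (snd t ≡ e))

-- An Euler family traverses each edge between two of its vertices; the third
-- vertex is the one the edge "picks". Along a closed trail every vertex is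
-- entered as often as it is left, so each vertex is an end of an even number of
-- traversals, and since its degree is even it is picked an even number of times:
-- this is (2). Conversely, once every edge picks a vertex, the two remaining
-- vertices of the edges form a loopless multigraph with even degrees, and
-- Euler's argument (walk along unused edges until the walk closes, splice closed
-- walks sharing a vertex) cuts it into vertex-disjoint closed trails. For (3),
-- edges picking the same vertex are paired up; conversely every edge picks the
-- vertex it shares with its partner.
module Submission where

open import Data.Bool using (Bool; true; false)
open import Data.Empty using (⊥; ⊥-elim)
open import Data.Fin using (Fin; zero; suc; inject₁; fromℕ)
open import Data.Fin.Properties using (_≟_; suc-injective)
open import Data.Fin.Subset using (Subset; _∈_; _∉_; _⊆_; ∣_∣; _-_; ⁅_⁆; ⊤; Nonempty)
open import Data.Fin.Subset.Properties
  using (x∈p∩q⁺; x∈p∩q⁻; p─q⊆p; p─⊥≡p; p⊆q⇒∣p∣≤∣q∣; x∈p⇒∣p-x∣<∣p∣;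
         x∈p∧x≢y⇒x∈p-y; x∈⁅x⁆; x∈⁅y⁆⇒x≡y; ∣⁅x⁆∣≡1; nonempty?)
open import Data.List as List using (List; []; _∷_; _++_; length; map; concat; filter; allFin)
open import Data.List.Membership.Propositional.Properties using (∈-lookup)
open import Data.List.Properties using (map-++)
open import Data.List.Relation.Binary.Subset.Propositional using () renaming (_⊆_ to _⊆ᴸ_)
open import Data.List.Relation.Unary.All as All using (All; []; _∷_)
import Data.List.Relation.Unary.All.Properties as All
open import Data.List.Relation.Unary.AllPairs using (AllPairs; []; _∷_)
open import Data.List.Relation.Unary.Any as Any using (Any; here; there)
import Data.List.Relation.Unary.Any.Properties as Any
open import Data.Nat using (ℕ; zero; suc; pred; _+_; _*_; _≤_; _<_; z≤n; s≤s)
open import Data.Nat.Divisibility using (_∣_; divides; ∣m∣n⇒∣m+n; ∣m+n∣m⇒∣n; ∣1⇒≡1; ∣-refl)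
open import Data.Nat.Induction using (<-wellFounded)
open import Data.Nat.ListAction using (sum)
open import Data.Nat.ListAction.Properties using (sum-++)
open import Data.Nat.Properties
  using (+-0-commutativeMonoid; +-comm; +-assoc; +-identityʳ; *-identityˡ; *-identityʳ; *-comm;
         *-distribʳ-+; +-cancelˡ-≡; +-mono-≤; m≤m+n; m≤n+m; ≤-reflexive; ≤-trans; ≤-<-trans;
         ≤-pred; module ≤-Reasoning)
open import Data.Nat.Tactic.RingSolver using (solve-∀)
open import Data.Product using (Σ; ∃; ∃!; _×_; _,_; proj₁; proj₂)
open import Data.Sum using (_⊎_; inj₁; inj₂)
open import Data.Vec using (_∷_; tabulate; lookup; here; there)
open import Data.Vec.Properties using (tabulate∘lookup; lookup⇒[]=; lookup-replicate)
open import Defs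
open import Function using (_∘_; id; _⇔_; mk⇔; Equivalence)
open import Induction.WellFounded using (WellFounded; Acc; acc)
open import Relation.Binary.PropositionalEquality
open import Relation.Nullary using (does; yes; no; contradiction)
open import Relation.Unary using (Decidable)
import Relation.Binary.Construct.On as On

open import Algebra.Properties.CommutativeMonoid.Sum +-0-commutativeMonoid
  using (sum-syntax; sum-cong-≗; sum-replicate-zero; ∑-distrib-+; ∑-comm; sum-init-last)

⟦_⟧ : Bool → ℕ
⟦ true ⟧ = 1
⟦ false ⟧ = 0

δ : ∀ {n} → Fin n → Fin n → ℕ
δ x y = ⟦ does (x ≟ y) ⟧

δ-refl : ∀ {n} (x : Fin n) → δ x x ≡ 1
δ-refl zero = refl
δ-refl (suc x) = δ-refl x

δ-≢ : ∀ {n} {x y : Fin n} → x ≢ y → δ x y ≡ 0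
δ-≢ {x = x} {y} x≢y with x ≟ y
... | yes x≡y = ⊥-elim (x≢y x≡y)
... | no _ = refl

δ-sym : ∀ {n} (x y : Fin n) → δ x y ≡ δ y x
δ-sym x y with x ≟ y | y ≟ x
... | yes _ | yes _ = refl
... | yes x≡y | no y≢x = contradiction (sym x≡y) y≢x
... | no x≢y | yes y≡x = contradiction (sym y≡x) x≢y
... | no _ | no _ = refl

δ-positive : ∀ {n} {x y : Fin n} → 0 < δ x y → x ≡ y
δ-positive {x = x} {y} 0<δ with x ≟ y
... | yes x≡y = x≡y

0<δ+δ⇔ : ∀ {n} {x y z : Fin n} → 0 < δ x z + δ y z ⇔ (x ≡ z ⊎ y ≡ z)
0<δ+δ⇔ {x = x} {y} {z} = mk⇔ to λ
  { (inj₁ refl) → ≤-trans (≤-reflexive (sym (δ-refl x))) (m≤m+n _ _)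
  ; (inj₂ refl) → ≤-trans (≤-reflexive (sym (δ-refl y))) (m≤n+m _ _)
  }
  where
  to : 0 < δ x z + δ y z → x ≡ z ⊎ y ≡ z
  to 0<δ+δ with x ≟ z
  ... | yes x≡z = inj₁ x≡z
  ... | no _ = inj₂ (δ-positive 0<δ+δ)

∑-zero : ∀ {n} (f : Fin n → ℕ) → (∀ i → f i ≡ 0) → ∑[ i < n ] f i ≡ 0
∑-zero {n} f f≡0 = trans (sum-cong-≗ f≡0) (sum-replicate-zero n)

∑-single : ∀ {n} (f : Fin n → ℕ) (k : Fin n) → (∀ i → i ≢ k → f i ≡ 0) → ∑[ i < n ] f i ≡ f k
∑-single {suc n} f zero f≡0 =
  trans (cong (f zero +_) (∑-zero (f ∘ suc) (λ i → f≡0 (suc i) λ ()))) (+-identityʳ (f zero))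
∑-single {suc n} f (suc k) f≡0 =
  cong₂ _+_ (f≡0 zero λ ()) (∑-single (f ∘ suc) k (λ i i≢k → f≡0 (suc i) (i≢k ∘ suc-injective)))

∑-δ* : ∀ {n} (x : Fin n) (f : Fin n → ℕ) → ∑[ y < n ] (δ x y * f y) ≡ f x
∑-δ* x f = begin
  ∑[ y < _ ] (δ x y * f y)  ≡⟨ ∑-single _ x (λ y y≢x → cong (_* f y) (δ-≢ (y≢x ∘ sym))) ⟩
  δ x x * f x               ≡⟨ cong (_* f x) (δ-refl x) ⟩
  1 * f x                   ≡⟨ *-identityˡ (f x) ⟩
  f x                       ∎
  where open ≡-Reasoning

∑-δ : ∀ {n} (x : Fin n) → ∑[ y < n ] δ x y ≡ 1
∑-δ x = trans (sum-cong-≗ (λ y → sym (*-identityʳ (δ x y)))) (∑-δ* x (λ _ → 1))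

∑-≤ : ∀ {n} (f : Fin n → ℕ) (i : Fin n) → f i ≤ ∑[ j < n ] f j
∑-≤ f zero = m≤m+n (f zero) _
∑-≤ f (suc i) = ≤-trans (∑-≤ (f ∘ suc) i) (m≤n+m _ (f zero))

∑-positive : ∀ {n} (f : Fin n → ℕ) → 0 < ∑[ i < n ] f i → ∃ λ i → 0 < f i
∑-positive {suc n} f 0<∑ with f zero in f₀≡
... | suc _ = zero , subst (0 <_) (sym f₀≡) (s≤s z≤n)
... | zero = let i , 0<fi = ∑-positive (f ∘ suc) 0<∑ in suc i , 0<fi

∑≤1⇒unique : ∀ {n} (f : Fin n → ℕ) → ∑[ i < n ] f i ≤ 1 → ∀ {i j} → 0 < f i → 0 < f j → i ≡ j
∑≤1⇒unique f ∑≤1 {zero} {zero} _ _ = refl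
∑≤1⇒unique f ∑≤1 {zero} {suc j} 0<f₀ 0<fj =
  contradiction (≤-trans (+-mono-≤ 0<f₀ (≤-trans 0<fj (∑-≤ (f ∘ suc) j))) ∑≤1) λ { (s≤s ()) }
∑≤1⇒unique f ∑≤1 {suc i} {zero} 0<fi 0<f₀ =
  contradiction (≤-trans (+-mono-≤ 0<f₀ (≤-trans 0<fi (∑-≤ (f ∘ suc) i))) ∑≤1) λ { (s≤s ()) }
∑≤1⇒unique f ∑≤1 {suc i} {suc j} 0<fi 0<fj =
  cong suc (∑≤1⇒unique (f ∘ suc) (≤-trans (m≤n+m _ (f zero)) ∑≤1) 0<fi 0<fj)

∑≡1⇒∃! : ∀ {n} (f : Fin n → ℕ) → ∑[ i < n ] f i ≡ 1 → ∃! _≡_ (λ i → 0 < f i)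
∑≡1⇒∃! f ∑≡1 =
  let i , 0<fi = ∑-positive f (≤-reflexive (sym ∑≡1))
  in i , 0<fi , ∑≤1⇒unique f (≤-reflexive ∑≡1) 0<fi

∃!-map : ∀ {A : Set} {P Q : A → Set} → (∀ {a} → P a ⇔ Q a) → ∃! _≡_ P → ∃! _≡_ Q
∃!-map P⇔Q (a , pa , unique) = a , Equivalence.to P⇔Q pa , unique ∘ Equivalence.from P⇔Q

∑-rotate : ∀ {n} (g : Fin (suc n) → ℕ) → g zero ≡ g (fromℕ n) →
           ∑[ i < n ] g (suc i) ≡ ∑[ i < n ] g (inject₁ i)
∑-rotate {n} g closed = +-cancelˡ-≡ (g zero) _ _ (begin
  g zero + ∑[ i < n ] g (suc i)          ≡⟨ sum-init-last g ⟩
  ∑[ i < n ] g (inject₁ i) + g (fromℕ n) ≡⟨ +-comm _ (g (fromℕ n)) ⟩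
  g (fromℕ n) + ∑[ i < n ] g (inject₁ i) ≡⟨ cong (_+ ∑[ i < n ] g (inject₁ i)) (sym closed) ⟩
  g zero + ∑[ i < n ] g (inject₁ i)      ∎)
  where open ≡-Reasoning

2∣m+m : ∀ m → 2 ∣ m + m
2∣m+m m = divides m (trans (cong (m +_) (sym (+-identityʳ m))) (*-comm 2 m))

2∣n+1⇒0<n : ∀ {n} → 2 ∣ n + 1 → 0 < n
2∣n+1⇒0<n {zero} 2∣1 = contradiction (∣1⇒≡1 2∣1) λ ()
2∣n+1⇒0<n {suc n} _ = s≤s z≤n

∣m+n∣n⇒∣m : ∀ {d m n} → d ∣ m + n → d ∣ n → d ∣ m
∣m+n∣n⇒∣m {d} {m} {n} d∣m+n d∣n = ∣m+n∣m⇒∣n (subst (d ∣_) (+-comm m n) d∣m+n) d∣n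

+-insert : ∀ x a b c d → a + b ≡ c + d → a + (x + b) ≡ c + (x + d)
+-insert x a b c d a+b≡c+d = begin
  a + (x + b)  ≡⟨ swap a x b ⟩
  x + (a + b)  ≡⟨ cong (x +_) a+b≡c+d ⟩
  x + (c + d)  ≡⟨ swap x c d ⟩
  c + (x + d)  ∎
  where
  open ≡-Reasoning
  swap : ∀ p q r → p + (q + r) ≡ q + (p + r)
  swap = solve-∀

∑-even : ∀ {n} (f : Fin n → ℕ) → (∀ i → 2 ∣ f i) → 2 ∣ ∑[ i < n ] f i
∑-even {zero} f _ = divides 0 refl
∑-even {suc n} f 2∣f = ∣m∣n⇒∣m+n (2∣f zero) (∑-even (f ∘ suc) (2∣f ∘ suc))

module _ {A : Set} where

  sum-map-++ : (g : A → ℕ) (xs ys : List A) → sum (map g (xs ++ ys)) ≡ sum (map g xs) + sum (map g ys)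
  sum-map-++ g xs ys = trans (cong sum (map-++ g xs ys)) (sum-++ (map g xs) (map g ys))

  sum-map-concat : (g : A → ℕ) (xss : List (List A)) → sum (map g (concat xss)) ≡ sum (map (sum ∘ map g) xss)
  sum-map-concat g [] = refl
  sum-map-concat g (xs ∷ xss) =
    trans (sum-map-++ g xs (concat xss)) (cong (sum (map g xs) +_) (sum-map-concat g xss))

  sum-map-tabulate : ∀ {n} (g : A → ℕ) (f : Fin n → A) → sum (map g (List.tabulate f)) ≡ ∑[ i < n ] g (f i)
  sum-map-tabulate {zero} g f = refl
  sum-map-tabulate {suc n} g f = cong (g (f zero) +_) (sum-map-tabulate g (f ∘ suc))

  sum-map-filter-tabulate : ∀ {P : A → Set} (P? : Decidable P) (g : A → ℕ) {n} (f : Fin n → A) →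
    sum (map g (filter P? (List.tabulate f))) ≡ ∑[ i < n ] (⟦ does (P? (f i)) ⟧ * g (f i))
  sum-map-filter-tabulate P? g {zero} f = refl
  sum-map-filter-tabulate P? g {suc n} f with does (P? (f zero))
  ... | true = cong₂ _+_ (sym (+-identityʳ (g (f zero)))) (sum-map-filter-tabulate P? g (f ∘ suc))
  ... | false = sum-map-filter-tabulate P? g (f ∘ suc)

  sum-map≡∑-lookup : (g : A → ℕ) (xs : List A) → sum (map g xs) ≡ ∑[ i < length xs ] g (List.lookup xs i)
  sum-map≡∑-lookup g [] = refl
  sum-map≡∑-lookup g (x ∷ xs) = cong (g x +_) (sum-map≡∑-lookup g xs)

  length≡sum-map-1 : (xs : List A) → length xs ≡ sum (map (λ _ → 1) xs)
  length≡sum-map-1 [] = refl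
  length≡sum-map-1 (x ∷ xs) = cong suc (length≡sum-map-1 xs)

  -- Inserting the loop rs′ ++ qs′ between qs and rs.
  sum-map-insert : (g : A → ℕ) (qs rs qs′ rs′ : List A) →
    sum (map g (qs ++ (rs′ ++ qs′) ++ rs)) ≡ sum (map g (qs ++ rs)) + sum (map g (qs′ ++ rs′))
  sum-map-insert g qs rs qs′ rs′ = begin
    ∑ᵍ (qs ++ (rs′ ++ qs′) ++ rs)        ≡⟨ sum-map-++ g qs _ ⟩
    ∑ᵍ qs + ∑ᵍ ((rs′ ++ qs′) ++ rs)       ≡⟨ cong (∑ᵍ qs +_) (sum-map-++ g (rs′ ++ qs′) rs) ⟩
    ∑ᵍ qs + (∑ᵍ (rs′ ++ qs′) + ∑ᵍ rs)     ≡⟨ cong (λ k → ∑ᵍ qs + (k + ∑ᵍ rs)) (sum-map-++ g rs′ qs′) ⟩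
    ∑ᵍ qs + ((∑ᵍ rs′ + ∑ᵍ qs′) + ∑ᵍ rs)  ≡⟨ reorder (∑ᵍ qs) (∑ᵍ rs′) (∑ᵍ qs′) (∑ᵍ rs) ⟩
    (∑ᵍ qs + ∑ᵍ rs) + (∑ᵍ qs′ + ∑ᵍ rs′)  ≡⟨ cong₂ _+_ (sum-map-++ g qs rs) (sum-map-++ g qs′ rs′) ⟨
    ∑ᵍ (qs ++ rs) + ∑ᵍ (qs′ ++ rs′)      ∎
    where
    open ≡-Reasoning
    ∑ᵍ : List A → ℕ
    ∑ᵍ = sum ∘ map g
    reorder : ∀ a b c d → a + ((b + c) + d) ≡ (a + d) + (c + b)
    reorder = solve-∀

  length-insert : (qs rs qs′ rs′ : List A) → length (qs ++ rs) ≤ length (qs ++ (rs′ ++ qs′) ++ rs)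
  length-insert qs rs qs′ rs′ = begin
    length (qs ++ rs)                               ≡⟨ length≡sum-map-1 (qs ++ rs) ⟩
    ∑1 (qs ++ rs)                                   ≤⟨ m≤m+n _ (∑1 (qs′ ++ rs′)) ⟩
    ∑1 (qs ++ rs) + ∑1 (qs′ ++ rs′)                 ≡⟨ sum-map-insert (λ _ → 1) qs rs qs′ rs′ ⟨
    ∑1 (qs ++ (rs′ ++ qs′) ++ rs)                   ≡⟨ length≡sum-map-1 (qs ++ (rs′ ++ qs′) ++ rs) ⟨
    length (qs ++ (rs′ ++ qs′) ++ rs)               ∎
    where
    open ≤-Reasoning
    ∑1 : List A → ℕ
    ∑1 = sum ∘ map (λ _ → 1)

  Any-insert⁻ : ∀ {P : A → Set} (qs rs qs′ rs′ : List A) →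
    Any P (qs ++ (rs′ ++ qs′) ++ rs) → Any P (qs ++ rs) ⊎ Any P (qs′ ++ rs′)
  Any-insert⁻ qs rs qs′ rs′ p with Any.++⁻ qs p
  ... | inj₁ inQs = inj₁ (Any.++⁺ˡ inQs)
  ... | inj₂ p′ with Any.++⁻ (rs′ ++ qs′) p′
  ...   | inj₂ inRs = inj₁ (Any.++⁺ʳ qs inRs)
  ...   | inj₁ p″ with Any.++⁻ rs′ p″
  ...     | inj₁ inRs′ = inj₂ (Any.++⁺ʳ qs′ inRs′)
  ...     | inj₂ inQs′ = inj₂ (Any.++⁺ˡ inQs′)

  pairUp : List A → List (A × A)
  pairUp (x ∷ y ∷ xs) = (x , y) ∷ pairUp xs
  pairUp _ = []

  sum-map-pairUp : (g : A → ℕ) (xs : List A) → 2 ∣ length xs →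
    sum (map (λ (x , y) → g x + g y) (pairUp xs)) ≡ sum (map g xs)
  sum-map-pairUp g [] _ = refl
  sum-map-pairUp g (x ∷ []) 2∣1 = contradiction (∣1⇒≡1 2∣1) λ ()
  sum-map-pairUp g (x ∷ y ∷ xs) 2∣2+len = begin
    (g x + g y) + sum (map (λ (x , y) → g x + g y) (pairUp xs))
      ≡⟨ cong (g x + g y +_) (sum-map-pairUp g xs (∣m+n∣m⇒∣n 2∣2+len ∣-refl)) ⟩
    (g x + g y) + sum (map g xs)
      ≡⟨ +-assoc (g x) (g y) _ ⟩
    g x + (g y + sum (map g xs))
      ∎
    where open ≡-Reasoning

  All-pairUp : ∀ {P : A → Set} {xs} → All P xs → All (λ (x , y) → P x × P y) (pairUp xs)
  All-pairUp [] = []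
  All-pairUp (_ ∷ []) = []
  All-pairUp (px ∷ py ∷ pxs) = (px , py) ∷ All-pairUp pxs

  AllPairs-lookup : ∀ {R : A → A → Set} → (∀ {a b} → R a b → R b a) →
    ∀ {xs} → AllPairs R xs → ∀ {i j} → i ≢ j → R (List.lookup xs i) (List.lookup xs j)
  AllPairs-lookup sym-R (_ ∷ _) {zero} {zero} i≢j = contradiction refl i≢j
  AllPairs-lookup sym-R (Rx ∷ _) {zero} {suc j} _ = All.lookup Rx (∈-lookup j)
  AllPairs-lookup sym-R (Rx ∷ _) {suc i} {zero} _ = sym-R (All.lookup Rx (∈-lookup i))
  AllPairs-lookup sym-R (_ ∷ Rxs) {suc i} {suc j} i≢j = AllPairs-lookup sym-R Rxs (i≢j ∘ cong suc)

∣tabulate∣≡∑ : ∀ {n} (f : Fin n → Bool) → ∣ tabulate f ∣ ≡ ∑[ x < n ] ⟦ f x ⟧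
∣tabulate∣≡∑ {zero} f = refl
∣tabulate∣≡∑ {suc n} f with f zero
... | true = cong suc (∣tabulate∣≡∑ (f ∘ suc))
... | false = ∣tabulate∣≡∑ (f ∘ suc)

∣p∣≡∑ : ∀ {n} (p : Subset n) → ∣ p ∣ ≡ ∑[ x < n ] ⟦ lookup p x ⟧
∣p∣≡∑ p = trans (cong ∣_∣ (sym (tabulate∘lookup p))) (∣tabulate∣≡∑ (lookup p))

⟦∉⟧≡0 : ∀ {n} {p : Subset n} {x} → x ∉ p → ⟦ lookup p x ⟧ ≡ 0
⟦∉⟧≡0 {p = p} {x} x∉p with lookup p x in px
... | true = contradiction (lookup⇒[]= x p px) x∉p
... | false = refl

0<⟦∈⟧*⇒ : ∀ {m} {p : Subset m} {x n} → 0 < ⟦ lookup p x ⟧ * n → x ∈ p × 0 < n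
0<⟦∈⟧*⇒ {p = p} {x} 0<⟦∈⟧*n with lookup p x in px
... | true = lookup⇒[]= x p px , subst (0 <_) (+-identityʳ _) 0<⟦∈⟧*n

⟦∈⟧-remove : ∀ {n} {p : Subset n} {x} → x ∈ p →
  ∀ y → ⟦ lookup p y ⟧ ≡ ⟦ lookup (p - x) y ⟧ + δ x y
⟦∈⟧-remove here zero = refl
⟦∈⟧-remove {p = _ ∷ p} here (suc y) =
  trans (cong (λ q → ⟦ lookup q y ⟧) (sym (p─⊥≡p p))) (sym (+-identityʳ _))
⟦∈⟧-remove (there _) zero = sym (+-identityʳ _)
⟦∈⟧-remove (there x∈p) (suc y) = ⟦∈⟧-remove x∈p y

∣p∣≡1+∣p-x∣ : ∀ {n} {p : Subset n} {x} → x ∈ p → ∣ p ∣ ≡ suc ∣ p - x ∣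
∣p∣≡1+∣p-x∣ {n} {p} {x} x∈p = begin
  ∣ p ∣                                                ≡⟨ ∣p∣≡∑ p ⟩
  ∑[ y < n ] ⟦ lookup p y ⟧                            ≡⟨ sum-cong-≗ (⟦∈⟧-remove x∈p) ⟩
  ∑[ y < n ] (⟦ lookup (p - x) y ⟧ + δ x y)            ≡⟨ ∑-distrib-+ _ (δ x) ⟩
  ∑[ y < n ] ⟦ lookup (p - x) y ⟧ + ∑[ y < n ] δ x y  ≡⟨ cong₂ _+_ (sym (∣p∣≡∑ (p - x))) (∑-δ x) ⟩
  ∣ p - x ∣ + 1                                        ≡⟨ +-comm _ 1 ⟩
  suc ∣ p - x ∣                                        ∎
  where open ≡-Reasoning

x∉p-x : ∀ {n} {p : Subset n} {x} → x ∉ p - x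
x∉p-x {p = _ ∷ _} {zero} ()
x∉p-x {p = _ ∷ _} {suc x} (there x∈p-x) = x∉p-x x∈p-x

∣p∣≡0⇒⟦∈⟧≡0 : ∀ {n} (p : Subset n) → ∣ p ∣ ≡ 0 → ∀ y → ⟦ lookup p y ⟧ ≡ 0
∣p∣≡0⇒⟦∈⟧≡0 (false ∷ p) ∣p∣≡0 zero = refl
∣p∣≡0⇒⟦∈⟧≡0 (false ∷ p) ∣p∣≡0 (suc y) = ∣p∣≡0⇒⟦∈⟧≡0 p ∣p∣≡0 y

0<∣p∣⇒nonempty : ∀ {n} (p : Subset n) → 0 < ∣ p ∣ → Nonempty p
0<∣p∣⇒nonempty (true ∷ p) _ = zero , here
0<∣p∣⇒nonempty (false ∷ p) 0<∣p∣ = let x , x∈p = 0<∣p∣⇒nonempty p 0<∣p∣ in suc x , there x∈p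

All∈-remove : ∀ {n} {p : Subset n} {x xs} → All (_∈ p) xs → All (x ≢_) xs → All (_∈ p - x) xs
All∈-remove xs∈p x≢xs =
  All.zipWith (λ (z∈p , x≢z) → x∈p∧x≢y⇒x∈p-y z∈p (x≢z ∘ sym)) (xs∈p , x≢xs)

⟦∈⟧-enumeration : ∀ {n} {p : Subset n} {xs : List (Fin n)} →
  length xs ≡ ∣ p ∣ → All (_∈ p) xs → AllPairs _≢_ xs →
  ∀ y → ⟦ lookup p y ⟧ ≡ sum (map (λ x → δ x y) xs)
⟦∈⟧-enumeration {p = p} {[]} 0≡∣p∣ [] [] y = ∣p∣≡0⇒⟦∈⟧≡0 p (sym 0≡∣p∣) y
⟦∈⟧-enumeration {p = p} {x ∷ xs} len (x∈p ∷ xs∈p) (x≢xs ∷ distinct) y = begin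
  ⟦ lookup p y ⟧
    ≡⟨ ⟦∈⟧-remove x∈p y ⟩
  ⟦ lookup (p - x) y ⟧ + δ x y
    ≡⟨ cong (_+ δ x y) (⟦∈⟧-enumeration len′ (All∈-remove xs∈p x≢xs) distinct y) ⟩
  sum (map (λ z → δ z y) xs) + δ x y
    ≡⟨ +-comm _ (δ x y) ⟩
  δ x y + sum (map (λ z → δ z y) xs)
    ∎
  where
  open ≡-Reasoning
  len′ : length xs ≡ ∣ p - x ∣
  len′ = cong pred (trans len (∣p∣≡1+∣p-x∣ x∈p))

fresh-member : ∀ {n} {p : Subset n} {xs : List (Fin n)} →
  length xs < ∣ p ∣ → All (_∈ p) xs → AllPairs _≢_ xs → ∃ λ y → y ∈ p × All (y ≢_) xs
fresh-member {p = p} {[]} 0<∣p∣ [] [] = let y , y∈p = 0<∣p∣⇒nonempty p 0<∣p∣ in y , y∈p , []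
fresh-member {p = p} {x ∷ xs} len (x∈p ∷ xs∈p) (x≢xs ∷ distinct) =
  let y , y∈p-x , y≢xs = fresh-member len′ (All∈-remove xs∈p x≢xs) distinct
  in y , p─q⊆p p ⁅ x ⁆ y∈p-x , (λ y≡x → x∉p-x (subst (_∈ p - x) y≡x y∈p-x)) ∷ y≢xs
  where
  len′ : length xs < ∣ p - x ∣
  len′ = ≤-pred (subst (suc (length xs) <_) (∣p∣≡1+∣p-x∣ x∈p) len)

⟦∈⟧-singleton : ∀ {n} {p : Subset n} {x} → ∣ p ∣ ≡ 1 → x ∈ p → ∀ y → ⟦ lookup p y ⟧ ≡ δ x y
⟦∈⟧-singleton ∣p∣≡1 x∈p y =
  trans (⟦∈⟧-enumeration (sym ∣p∣≡1) (x∈p ∷ []) ([] ∷ []) y) (+-identityʳ _)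

⟦∈⟧-triple : ∀ {n} {p : Subset n} {x y z} → ∣ p ∣ ≡ 3 → x ∈ p → y ∈ p → z ∈ p →
  x ≢ y → x ≢ z → y ≢ z → ∀ v → ⟦ lookup p v ⟧ ≡ δ x v + (δ y v + δ z v)
⟦∈⟧-triple {x = x} {y} {z} ∣p∣≡3 x∈p y∈p z∈p x≢y x≢z y≢z v =
  trans (⟦∈⟧-enumeration (sym ∣p∣≡3) (x∈p ∷ y∈p ∷ z∈p ∷ [])
                          ((x≢y ∷ x≢z ∷ []) ∷ (y≢z ∷ []) ∷ [] ∷ []) v)
        (cong (λ k → δ x v + (δ y v + k)) (+-identityʳ (δ z v)))

-- Reindexing along an ordered partition

record OrderedPartition (m : ℕ) : Set where
  field
    blocks       : ℕ
    size         : Fin blocks → ℕ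
    label        : ∀ t → Fin (size t) → Fin m
    block        : Fin m → Fin blocks
    index        : ∀ x → Fin (size (block x))
    label-index  : ∀ x → label (block x) (index x) ≡ x
    block-unique : ∀ x t i → label t i ≡ x → t ≡ block x
    index-unique : ∀ x i → label (block x) i ≡ x → i ≡ index x

module _ {m} (P : OrderedPartition m) where
  open OrderedPartition P

  ∑-blocks-δ : ∀ x (f : ∀ t → Fin (size t) → ℕ) →
    ∑[ t < blocks ] ∑[ i < size t ] (δ (label t i) x * f t i) ≡ f (block x) (index x)
  ∑-blocks-δ x f = begin
    ∑[ t < blocks ] ∑[ i < size t ] (δ (label t i) x * f t i)  ≡⟨ ∑-single _ (block x) other-block ⟩
    ∑[ i < size bx ] (δ (label bx i) x * f bx i)               ≡⟨ ∑-single _ (index x) other-index ⟩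
    δ (label bx ix) x * f bx ix                                ≡⟨ cong (λ y → δ y x * f bx ix) (label-index x) ⟩
    δ x x * f bx ix                                            ≡⟨ cong (_* f bx ix) (δ-refl x) ⟩
    1 * f bx ix                                                ≡⟨ *-identityˡ _ ⟩
    f bx ix                                                    ∎
    where
    open ≡-Reasoning
    bx : Fin blocks
    bx = block x
    ix : Fin (size bx)
    ix = index x
    other-block : ∀ t → t ≢ bx → ∑[ i < size t ] (δ (label t i) x * f t i) ≡ 0
    other-block t t≢bx = ∑-zero _ λ i → cong (_* f t i) (δ-≢ (t≢bx ∘ block-unique x t i))
    other-index : ∀ i → i ≢ index x → δ (label bx i) x * f bx i ≡ 0
    other-index i i≢ix = cong (_* f bx i) (δ-≢ (i≢ix ∘ index-unique x i))

  ∑-reindex : (f : ∀ t → Fin (size t) → ℕ) →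
    ∑[ x < m ] f (block x) (index x) ≡ ∑[ t < blocks ] ∑[ i < size t ] f t i
  ∑-reindex f = begin
    ∑[ x < m ] f (block x) (index x)
      ≡⟨ sum-cong-≗ (λ x → ∑-blocks-δ x f) ⟨
    ∑[ x < m ] ∑[ t < blocks ] ∑[ i < size t ] term t i x
      ≡⟨ ∑-comm (λ x t → ∑[ i < size t ] term t i x) ⟩
    ∑[ t < blocks ] ∑[ x < m ] ∑[ i < size t ] term t i x
      ≡⟨ sum-cong-≗ (λ t → ∑-comm (λ x i → term t i x)) ⟩
    ∑[ t < blocks ] ∑[ i < size t ] ∑[ x < m ] term t i x
      ≡⟨ sum-cong-≗ (λ t → sum-cong-≗ λ i → ∑-δ* (label t i) (λ _ → f t i)) ⟩
    ∑[ t < blocks ] ∑[ i < size t ] f t i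
      ∎
    where
    open ≡-Reasoning
    term : ∀ t → Fin (size t) → Fin m → ℕ
    term t i x = δ (label t i) x * f t i

fibreSize : ∀ {m n} → (Fin m → Fin n) → Fin n → ℕ
fibreSize {m} f y = ∑[ i < m ] δ (f i) y

EvenFibres : ∀ {m n} → (Fin m → Fin n) → Set
EvenFibres f = ∀ y → 2 ∣ fibreSize f y

∣tabulate∣≡fibreSize : ∀ {m n} (sel : Fin m → Subset n) (s : Fin m → Fin n) →
  (∀ e → ∣ sel e ∣ ≡ 1) → (∀ e → s e ∈ sel e) →
  ∀ v → ∣ tabulate (λ e → lookup (sel e) v) ∣ ≡ fibreSize s v
∣tabulate∣≡fibreSize sel s ∣sel∣≡1 s∈sel v =
  trans (∣tabulate∣≡∑ (λ e → lookup (sel e) v))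
        (sum-cong-≗ λ e → ⟦∈⟧-singleton (∣sel∣≡1 e) (s∈sel e) v)

record Pairing {m n} (s : Fin m → Fin n) : Set where
  field
    pairs : List (Fin m × Fin m)
    same  : All (λ (x , y) → s x ≡ s y) pairs
    once  : ∀ e → sum (map (λ (x , y) → δ x e + δ y e) pairs) ≡ 1

fibreList : ∀ {m n} → (Fin m → Fin n) → Fin n → List (Fin m)
fibreList {m} s v = filter (λ e → s e ≟ v) (allFin m)

sum-map-fibreList : ∀ {m n} (s : Fin m → Fin n) v (g : Fin m → ℕ) →
  sum (map g (fibreList s v)) ≡ ∑[ e < m ] (δ (s e) v * g e)
sum-map-fibreList s v g = sum-map-filter-tabulate (λ e → s e ≟ v) g id

length-fibreList : ∀ {m n} (s : Fin m → Fin n) v → length (fibreList s v) ≡ fibreSize s v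
length-fibreList {m} s v = begin
  length (fibreList s v)               ≡⟨ length≡sum-map-1 (fibreList s v) ⟩
  sum (map (λ _ → 1) (fibreList s v))  ≡⟨ sum-map-fibreList s v (λ _ → 1) ⟩
  ∑[ e < m ] (δ (s e) v * 1)           ≡⟨ sum-cong-≗ (λ e → *-identityʳ (δ (s e) v)) ⟩
  fibreSize s v                        ∎
  where open ≡-Reasoning

-- Pair up consecutive elements of each fibre.
EvenFibres⇒Pairing : ∀ {m n} (s : Fin m → Fin n) → EvenFibres s → Pairing s
EvenFibres⇒Pairing {m} {n} s even = record { pairs = pairs ; same = same ; once = once }
  where
  fibre : Fin n → List (Fin m)
  fibre = fibreList s
  pairs : List (Fin m × Fin m)
  pairs = concat (List.tabulate (pairUp ∘ fibre))
  same : All (λ (x , y) → s x ≡ s y) pairs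
  same = All.concat⁺ (All.tabulate⁺ λ v →
    All.map (λ (sx≡v , sy≡v) → trans sx≡v (sym sy≡v))
            (All-pairUp (All.all-filter (λ e → s e ≟ v) (allFin m))))
  once : ∀ e → sum (map (λ (x , y) → δ x e + δ y e) pairs) ≡ 1
  once e = begin
    sum (map (λ (x , y) → δ x e + δ y e) pairs)
      ≡⟨ sum-map-concat _ (List.tabulate (pairUp ∘ fibre)) ⟩
    sum (map (λ ps → sum (map (λ (x , y) → δ x e + δ y e) ps)) (List.tabulate (pairUp ∘ fibre)))
      ≡⟨ sum-map-tabulate _ (pairUp ∘ fibre) ⟩
    ∑[ v < n ] sum (map (λ (x , y) → δ x e + δ y e) (pairUp (fibre v)))
      ≡⟨ sum-cong-≗ (λ v → sum-map-pairUp (λ x → δ x e) (fibre v)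
                             (subst (2 ∣_) (sym (length-fibreList s v)) (even v))) ⟩
    ∑[ v < n ] sum (map (λ x → δ x e) (fibre v))
      ≡⟨ sum-cong-≗ (λ v → sum-map-fibreList s v (λ x → δ x e)) ⟩
    ∑[ v < n ] ∑[ x < m ] (δ (s x) v * δ x e)
      ≡⟨ sum-cong-≗ (λ v → sum-cong-≗ λ x →
           trans (*-comm _ (δ x e)) (cong (_* δ (s x) v) (δ-sym x e))) ⟩
    ∑[ v < n ] ∑[ x < m ] (δ e x * δ (s x) v)
      ≡⟨ sum-cong-≗ (λ v → ∑-δ* e (λ x → δ (s x) v)) ⟩
    ∑[ v < n ] δ (s e) v
      ≡⟨ ∑-δ (s e) ⟩
    1 ∎
    where open ≡-Reasoning

-- Choices and traversals

module _ (H : Hypergraph) where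
  open Hypergraph H

  record Choice : Set where
    field
      pick  : Fin nE → Fin nV
      pick∈ : ∀ e → pick e ∈ inc e

  record Traversal : Set where
    field
      src tgt : Fin nE → Fin nV
      src≢tgt : ∀ e → src e ≢ tgt e
      src∈    : ∀ e → src e ∈ inc e
      tgt∈    : ∀ e → tgt e ∈ inc e

  EvenChoice : Set
  EvenChoice = Σ Choice λ C → EvenFibres (Choice.pick C)

  EvenTraversal : Set
  EvenTraversal = Σ Traversal λ T → ∀ v → 2 ∣ fibreSize (Traversal.src T) v + fibreSize (Traversal.tgt T) v

  Complementary : Choice → Traversal → Set
  Complementary C T = ∀ e → pick e ≢ src e × pick e ≢ tgt e
    where open Choice C; open Traversal T

module _ {H : Hypergraph} where
  open Hypergraph H

  EvenOneSubgraph⇔EvenChoice : EvenOneSubgraph H ⇔ EvenChoice H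
  EvenOneSubgraph⇔EvenChoice = mk⇔ to from
    where
    to : EvenOneSubgraph H → EvenChoice H
    to S = record { pick = pick ; pick∈ = λ e → sub e (pick∈sel e) } ,
           λ v → subst (2 ∣_) (∣tabulate∣≡fibreSize sel pick degE pick∈sel v) (degV v)
      where
      open EvenOneSubgraph S
      member : ∀ e → Nonempty (sel e)
      member e = 0<∣p∣⇒nonempty (sel e) (≤-reflexive (sym (degE e)))
      pick : Fin nE → Fin nV
      pick = proj₁ ∘ member
      pick∈sel : ∀ e → pick e ∈ sel e
      pick∈sel = proj₂ ∘ member
    from : EvenChoice H → EvenOneSubgraph H
    from (C , even) = record
      { sel  = sel
      ; sub  = λ e x∈sel → subst (_∈ inc e) (sym (x∈⁅y⁆⇒x≡y (pick e) x∈sel)) (pick∈ e)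
      ; degE = ∣sel∣≡1
      ; degV = λ v →
          subst (2 ∣_) (sym (∣tabulate∣≡fibreSize sel pick ∣sel∣≡1 (x∈⁅x⁆ ∘ pick) v)) (even v)
      }
      where
      open Choice C
      sel : Fin nE → Subset nV
      sel e = ⁅ pick e ⁆
      ∣sel∣≡1 : ∀ e → ∣ sel e ∣ ≡ 1
      ∣sel∣≡1 e = ∣⁅x⁆∣≡1 (pick e)

module _ {H : Hypergraph} (uniform : ThreeUniform H) where
  open Hypergraph H

  degree≡fibreSizes : (C : Choice H) (T : Traversal H) → Complementary H C T →
    ∀ v → degree H v ≡ fibreSize (Choice.pick C) v
                       + (fibreSize (Traversal.src T) v + fibreSize (Traversal.tgt T) v)
  degree≡fibreSizes C T complementary v = begin
    degree H v
      ≡⟨ ∣tabulate∣≡∑ (λ e → lookup (inc e) v) ⟩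
    ∑[ e < nE ] ⟦ lookup (inc e) v ⟧
      ≡⟨ sum-cong-≗ split ⟩
    ∑[ e < nE ] (δ (pick e) v + (δ (src e) v + δ (tgt e) v))
      ≡⟨ ∑-distrib-+ (λ e → δ (pick e) v) _ ⟩
    fibreSize pick v + ∑[ e < nE ] (δ (src e) v + δ (tgt e) v)
      ≡⟨ cong (fibreSize pick v +_) (∑-distrib-+ (λ e → δ (src e) v) _) ⟩
    fibreSize pick v + (fibreSize src v + fibreSize tgt v)
      ∎
    where
    open ≡-Reasoning
    open Choice C
    open Traversal T
    split : ∀ e → ⟦ lookup (inc e) v ⟧ ≡ δ (pick e) v + (δ (src e) v + δ (tgt e) v)
    split e = let pick≢src , pick≢tgt = complementary e in
      ⟦∈⟧-triple (uniform e) (pick∈ e) (src∈ e) (tgt∈ e) pick≢src pick≢tgt (src≢tgt e) v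

  complementaryChoice : (T : Traversal H) → Σ (Choice H) λ C → Complementary H C T
  complementaryChoice T =
    record { pick = proj₁ ∘ third ; pick∈ = proj₁ ∘ proj₂ ∘ third } ,
    λ e → let avoids = proj₂ (proj₂ (third e)) in All.head avoids , All.head (All.tail avoids)
    where
    open Traversal T
    third : ∀ e → ∃ λ y → y ∈ inc e × All (y ≢_) (src e ∷ tgt e ∷ [])
    third e = fresh-member (≤-reflexive (sym (uniform e)))
                           (src∈ e ∷ tgt∈ e ∷ []) ((src≢tgt e ∷ []) ∷ [] ∷ [])

  complementaryTraversal : (C : Choice H) → Σ (Traversal H) (Complementary H C)
  complementaryTraversal C =
    record
      { src = src ; tgt = tgt ; src≢tgt = src≢tgt
      ; src∈ = proj₁ ∘ proj₂ ∘ second ; tgt∈ = proj₁ ∘ proj₂ ∘ third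
      } ,
    λ e → src≢pick e ∘ sym , tgt≢pick e ∘ sym
    where
    open Choice C
    second : ∀ e → ∃ λ y → y ∈ inc e × All (y ≢_) (pick e ∷ [])
    second e = fresh-member (≤-trans (s≤s (s≤s z≤n)) (≤-reflexive (sym (uniform e))))
                            (pick∈ e ∷ []) ([] ∷ [])
    src : Fin nE → Fin nV
    src = proj₁ ∘ second
    src≢pick : ∀ e → src e ≢ pick e
    src≢pick e = All.head (proj₂ (proj₂ (second e)))
    third : ∀ e → ∃ λ y → y ∈ inc e × All (y ≢_) (pick e ∷ src e ∷ [])
    third e = fresh-member (≤-reflexive (sym (uniform e))) (pick∈ e ∷ proj₁ (proj₂ (second e)) ∷ [])
                           ((src≢pick e ∘ sym ∷ []) ∷ [] ∷ [])
    tgt : Fin nE → Fin nV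
    tgt = proj₁ ∘ third
    tgt≢pick : ∀ e → tgt e ≢ pick e
    tgt≢pick e = All.head (proj₂ (proj₂ (third e)))
    src≢tgt : ∀ e → src e ≢ tgt e
    src≢tgt e = All.head (All.tail (proj₂ (proj₂ (third e)))) ∘ sym

  EvenTraversal⇔EvenChoice : EvenDegrees H → EvenTraversal H ⇔ EvenChoice H
  EvenTraversal⇔EvenChoice even = mk⇔
    (λ (T , evenT) → let C , complementary = complementaryChoice T in
      C , λ v → ∣m+n∣n⇒∣m (subst (2 ∣_) (degree≡fibreSizes C T complementary v) (even v)) (evenT v))
    (λ (C , evenC) → let T , complementary = complementaryTraversal C in
      T , λ v → ∣m+n∣m⇒∣n (subst (2 ∣_) (degree≡fibreSizes C T complementary v) (even v)) (evenC v))

module _ {H : Hypergraph} where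
  open Hypergraph H

  module _ (P : IntersectingPairPartition H) where
    open IntersectingPairPartition P

    private
      Contains : Fin size → Fin nE → Set
      Contains t e = (fst t ≡ e) ⊎ (snd t ≡ e)

      member : Fin size → Fin 2 → Fin nE
      member t zero = fst t
      member t (suc zero) = snd t

      position : ∀ {t e} → Contains t e → Fin 2
      position (inj₁ _) = zero
      position (inj₂ _) = suc zero

      member-position : ∀ {t e} (c : Contains t e) → member t (position c) ≡ e
      member-position (inj₁ fst≡e) = fst≡e
      member-position (inj₂ snd≡e) = snd≡e

      member⇒contains : ∀ t i {e} → member t i ≡ e → Contains t e
      member⇒contains t zero = inj₁
      member⇒contains t (suc zero) = inj₂

      position-unique : ∀ {t e} i (c : Contains t e) → member t i ≡ e → i ≡ position c
      position-unique zero (inj₁ _) _ = refl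
      position-unique {t} zero (inj₂ snd≡e) fst≡e = ⊥-elim (pairDiff t (trans fst≡e (sym snd≡e)))
      position-unique {t} (suc zero) (inj₁ fst≡e) snd≡e = ⊥-elim (pairDiff t (trans fst≡e (sym snd≡e)))
      position-unique (suc zero) (inj₂ _) _ = refl

      contains : ∀ e → Contains (proj₁ (partition e)) e
      contains e = proj₁ (proj₂ (partition e))

    pairPartition : OrderedPartition nE
    pairPartition = record
      { blocks       = size
      ; size         = λ _ → 2
      ; label        = member
      ; block        = proj₁ ∘ partition
      ; index        = position ∘ contains
      ; label-index  = member-position ∘ contains
      ; block-unique = λ e t i member≡e →
          sym (proj₂ (proj₂ (partition e)) (member⇒contains t i member≡e))
      ; index-unique = λ e i member≡e → position-unique i (contains e) member≡e
      }

    IntersectingPairPartition⇒EvenChoice : EvenChoice H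
    IntersectingPairPartition⇒EvenChoice = C , even
      where
      open OrderedPartition pairPartition using (block; index; label-index)
      common : Fin size → Fin nV
      common t = proj₁ (meet t)
      common∈ : ∀ t i → common t ∈ inc (member t i)
      common∈ t zero = proj₁ (x∈p∩q⁻ (inc (fst t)) (inc (snd t)) (proj₂ (meet t)))
      common∈ t (suc zero) = proj₂ (x∈p∩q⁻ (inc (fst t)) (inc (snd t)) (proj₂ (meet t)))
      C : Choice H
      C = record
        { pick  = common ∘ block
        ; pick∈ = λ e → subst (λ e′ → common (block e) ∈ inc e′) (label-index e)
                              (common∈ (block e) (index e))
        }
      even : EvenFibres (common ∘ block)
      even v = subst (2 ∣_) (sym (∑-reindex pairPartition (λ t _ → δ (common t) v)))
        (∑-even _ λ t →
          subst (2 ∣_) (cong (δ (common t) v +_) (sym (+-identityʳ _))) (2∣m+m (δ (common t) v)))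

  EvenChoice⇒IntersectingPairPartition : EvenChoice H → IntersectingPairPartition H
  EvenChoice⇒IntersectingPairPartition (C , even) = record
    { size      = length pairs
    ; fst       = fst
    ; snd       = snd
    ; pairDiff  = pairDiff
    ; meet      = λ t → pick (fst t) ,
                    x∈p∩q⁺ (pick∈ (fst t) , subst (_∈ inc (snd t)) (sym (same-pick t)) (pick∈ (snd t)))
    ; partition = λ e → ∃!-map 0<δ+δ⇔ (∑≡1⇒∃! (hits e) (∑-hits e))
    }
    where
    open Choice C
    open Pairing (EvenFibres⇒Pairing pick even)
    fst snd : Fin (length pairs) → Fin nE
    fst t = proj₁ (List.lookup pairs t)
    snd t = proj₂ (List.lookup pairs t)
    same-pick : ∀ t → pick (fst t) ≡ pick (snd t)
    same-pick t = All.lookup same (∈-lookup t)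
    hits : Fin nE → Fin (length pairs) → ℕ
    hits e t = δ (fst t) e + δ (snd t) e
    ∑-hits : ∀ e → ∑[ t < length pairs ] hits e t ≡ 1
    ∑-hits e = trans (sym (sum-map≡∑-lookup _ pairs)) (once e)
    pairDiff : ∀ t → fst t ≢ snd t
    pairDiff t fst≡snd = contradiction (subst (_≤ 1) hits≡2 hits≤1) λ { (s≤s ()) }
      where
      hits≤1 : hits (fst t) t ≤ 1
      hits≤1 = ≤-trans (∑-≤ (hits (fst t)) t) (≤-reflexive (∑-hits (fst t)))
      hits≡2 : hits (fst t) t ≡ 2
      hits≡2 = cong₂ _+_ (δ-refl (fst t))
                          (trans (cong (λ y → δ y (fst t)) (sym fst≡snd)) (δ-refl (fst t)))

  IntersectingPairPartition⇔EvenChoice : IntersectingPairPartition H ⇔ EvenChoice H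
  IntersectingPairPartition⇔EvenChoice =
    mk⇔ IntersectingPairPartition⇒EvenChoice EvenChoice⇒IntersectingPairPartition

module _ {H : Hypergraph} where
  open Hypergraph H
  open ClosedStrictTrail

  closedTrail-even : (T : ClosedStrictTrail H) →
    ∀ v → 2 ∣ ∑[ i < len T ] (δ (anchor T (inject₁ i)) v + δ (anchor T (suc i)) v)
  closedTrail-even T v = subst (2 ∣_) (sym (begin
    ∑[ i < len T ] (at (inject₁ i) + at (suc i))                ≡⟨ ∑-distrib-+ (at ∘ inject₁) (at ∘ suc) ⟩
    ∑[ i < len T ] at (inject₁ i) + ∑[ i < len T ] at (suc i)   ≡⟨ cong (∑[ i < len T ] at (inject₁ i) +_) rotate ⟩
    ∑[ i < len T ] at (inject₁ i) + ∑[ i < len T ] at (inject₁ i) ∎))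
    (2∣m+m (∑[ i < len T ] at (inject₁ i)))
    where
    open ≡-Reasoning
    at : Fin (suc (len T)) → ℕ
    at k = δ (anchor T k) v
    rotate : ∑[ i < len T ] at (suc i) ≡ ∑[ i < len T ] at (inject₁ i)
    rotate = ∑-rotate at (cong (λ y → δ y v) (closed T))

  trailPartition : EulerFamily H → OrderedPartition nE
  trailPartition F = record
    { blocks       = size
    ; size         = len ∘ trail
    ; label        = edge ∘ trail
    ; block        = block
    ; index        = index
    ; label-index  = label-index
    ; block-unique = λ e t i edge≡e → sym (proj₂ (proj₂ (cover e)) (i , edge≡e))
    ; index-unique = λ e i edge≡e → strict (trail (block e)) i (index e) (trans edge≡e (sym (label-index e)))
    }
    where
    open EulerFamily F
    block : Fin nE → Fin size
    block e = proj₁ (cover e)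
    index : ∀ e → Fin (len (trail (block e)))
    index e = proj₁ (proj₁ (proj₂ (cover e)))
    label-index : ∀ e → edge (trail (block e)) (index e) ≡ e
    label-index e = proj₂ (proj₁ (proj₂ (cover e)))

  EulerFamily⇒EvenTraversal : EulerFamily H → EvenTraversal H
  EulerFamily⇒EvenTraversal F = T , even
    where
    open EulerFamily F using (trail)
    open OrderedPartition (trailPartition F)
    src tgt : Fin nE → Fin nV
    src e = anchor (trail (block e)) (inject₁ (index e))
    tgt e = anchor (trail (block e)) (suc (index e))
    step∈ : ∀ e → (src e ∈ inc e) × (tgt e ∈ inc e)
    step∈ e = subst (λ e′ → (src e ∈ inc e′) × (tgt e ∈ inc e′)) (label-index e)
                    (inEdge (trail (block e)) (index e))
    T : Traversal H
    T = record
      { src     = src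
      ; tgt     = tgt
      ; src≢tgt = λ e → distinct (trail (block e)) (index e)
      ; src∈    = proj₁ ∘ step∈
      ; tgt∈    = proj₂ ∘ step∈
      }
    even : ∀ v → 2 ∣ fibreSize src v + fibreSize tgt v
    even v = subst (2 ∣_) (sym (begin
      fibreSize src v + fibreSize tgt v                  ≡⟨ ∑-distrib-+ (λ e → δ (src e) v) _ ⟨
      ∑[ e < nE ] (δ (src e) v + δ (tgt e) v)            ≡⟨ ∑-reindex (trailPartition F) ends ⟩
      ∑[ t < blocks ] ∑[ i < size t ] ends t i           ∎))
      (∑-even _ λ t → closedTrail-even (trail t) v)
      where
      open ≡-Reasoning
      ends : ∀ t → Fin (len (trail t)) → ℕ
      ends t i = δ (anchor (trail t) (inject₁ i)) v + δ (anchor (trail t) (suc i)) v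

-- Euler decomposition of the multigraph of a traversal

module EulerDecomposition {H : Hypergraph} (T : Traversal H) where
  open Hypergraph H
  open Traversal T

  Step : Fin nV → Fin nE → Fin nV → Set
  Step x e y = (x ≡ src e × y ≡ tgt e) ⊎ (x ≡ tgt e × y ≡ src e)

  Steps : Set
  Steps = List (Fin nE × Fin nV)

  -- A walk is recorded by its steps (edge taken, vertex reached).
  infixr 5 _∷_
  data Walk : Fin nV → Steps → Fin nV → Set where
    []  : ∀ {x} → Walk x [] x
    _∷_ : ∀ {x e y ps z} → Step x e y → Walk y ps z → Walk x ((e , y) ∷ ps) z

  uses : Fin nE → Steps → ℕ
  uses e ps = sum (map (λ (e′ , _) → δ e′ e) ps)

  Visits : Steps → Fin nV → Set
  Visits ps v = Any (λ (_ , y) → y ≡ v) ps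

  ends : Fin nE → Fin nV → ℕ
  ends e v = δ (src e) v + δ (tgt e) v

  step-ends : ∀ {x e y} → Step x e y → ∀ v → ends e v ≡ δ x v + δ y v
  step-ends (inj₁ (refl , refl)) v = refl
  step-ends {e = e} (inj₂ (refl , refl)) v = +-comm (δ (src e) v) (δ (tgt e) v)

  step-from : ∀ {x} e → src e ≡ x ⊎ tgt e ≡ x → ∃ λ y → Step x e y
  step-from e (inj₁ refl) = tgt e , inj₁ (refl , refl)
  step-from e (inj₂ refl) = src e , inj₂ (refl , refl)

  step-distinct : ∀ {x e y} → Step x e y → x ≢ y
  step-distinct {e = e} (inj₁ (refl , refl)) = src≢tgt e
  step-distinct {e = e} (inj₂ (refl , refl)) = src≢tgt e ∘ sym

  step-∈ : ∀ {x e y} → Step x e y → x ∈ inc e × y ∈ inc e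
  step-∈ {e = e} (inj₁ (refl , refl)) = src∈ e , tgt∈ e
  step-∈ {e = e} (inj₂ (refl , refl)) = tgt∈ e , src∈ e

  walk-++ : ∀ {x y z ps qs} → Walk x ps y → Walk y qs z → Walk x (ps ++ qs) z
  walk-++ [] w = w
  walk-++ (s ∷ w) w′ = s ∷ walk-++ w w′

  walk-split : ∀ {x y v ps} → Walk x ps y → Visits ps v →
    ∃ λ qs → ∃ λ rs → ps ≡ qs ++ rs × Walk x qs v × Walk v rs y
  walk-split (s ∷ w) (here refl) = _ , _ , refl , s ∷ [] , w
  walk-split (s ∷ w) (there visit) =
    let qs , rs , ps≡ , wq , wr = walk-split w visit in _ , rs , cong (_ ∷_) ps≡ , s ∷ wq , wr

  walk-nonempty : ∀ {x y ps} → Walk x ps y → x ≢ y → 0 < length ps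
  walk-nonempty [] x≢x = contradiction refl x≢x
  walk-nonempty (_ ∷ _) _ = s≤s z≤n

  record Circuit : Set where
    field
      start : Fin nV
      steps : Steps
      walk  : Walk start steps start
      long  : 2 ≤ length steps
  open Circuit

  VertexDisjoint : Circuit → Circuit → Set
  VertexDisjoint C D = ∀ {v} → Visits (steps C) v → Visits (steps D) v → ⊥

  meet? : ∀ ps qs → (∃ λ v → Visits ps v × Visits qs v) ⊎ (∀ {v} → Visits ps v → Visits qs v → ⊥)
  meet? [] qs = inj₂ λ ()
  meet? ((e , y) ∷ ps) qs with Any.any? (λ (_ , w) → w ≟ y) qs | meet? ps qs
  ... | yes visit | _ = inj₁ (y , here refl , visit)
  ... | no _ | inj₁ (v , visit , visit′) = inj₁ (v , there visit , visit′)
  ... | no ¬visit | inj₂ apart = inj₂ λ { (here refl) → ¬visit ; (there visit) → apart visit }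

  record Splice (C D : Circuit) : Set where
    field
      circuit : Circuit
      visits  : ∀ {v} → Visits (steps circuit) v → Visits (steps C) v ⊎ Visits (steps D) v
      count   : ∀ e → uses e (steps circuit) ≡ uses e (steps C) + uses e (steps D)

  -- Go around C up to the shared vertex, all the way around D, then finish C.
  splice : ∀ C D {v} → Visits (steps C) v → Visits (steps D) v → Splice C D
  splice C@record { walk = walkC } D@record { walk = walkD } visitC visitD
    with walk-split walkC visitC | walk-split walkD visitD
  ... | qs , rs , refl , wq , wr | qs′ , rs′ , refl , wq′ , wr′ = record
    { circuit = record
        { start = start C
        ; steps = qs ++ (rs′ ++ qs′) ++ rs
        ; walk  = walk-++ wq (walk-++ (walk-++ wr′ wq′) wr)
        ; long  = ≤-trans (long C) (length-insert qs rs qs′ rs′)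
        }
    ; visits  = Any-insert⁻ qs rs qs′ rs′
    ; count   = λ e → sum-map-insert _ qs rs qs′ rs′
    }

  usesAll : Fin nE → List Circuit → ℕ
  usesAll e Cs = sum (map (uses e ∘ steps) Cs)

  record Absorption (C : Circuit) (Cs : List Circuit) : Set where
    field
      circuit   : Circuit
      others    : List Circuit
      others⊆Cs : others ⊆ᴸ Cs
      disjoint  : AllPairs VertexDisjoint (circuit ∷ others)
      count     : ∀ e → uses e (steps circuit) + usesAll e others ≡ uses e (steps C) + usesAll e Cs

  absorb-next : ∀ {C Cs D} → All (VertexDisjoint D) Cs → Absorption C Cs → Absorption C (D ∷ Cs)
  absorb-next {C} {Cs} {D} D-apart
    record { circuit = C′ ; others = Cs′ ; others⊆Cs = Cs′⊆Cs ; disjoint = C′-apart ∷ disjointCs′ ; count = count }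
    = extend (meet? (steps C′) (steps D))
    where
    D-apart′ : All (VertexDisjoint D) Cs′
    D-apart′ = All.anti-mono {P = VertexDisjoint D} Cs′⊆Cs D-apart
    count-next : ∀ e → uses e (steps C′) + (uses e (steps D) + usesAll e Cs′) ≡ uses e (steps C) + usesAll e (D ∷ Cs)
    count-next e = +-insert (uses e (steps D)) (uses e (steps C′)) (usesAll e Cs′) (uses e (steps C)) (usesAll e Cs)
                            (count e)
    extend : (∃ λ v → Visits (steps C′) v × Visits (steps D) v) ⊎ VertexDisjoint C′ D → Absorption C (D ∷ Cs)
    extend (inj₁ (v , visitC′ , visitD)) = record
      { circuit   = Splice.circuit S
      ; others    = Cs′
      ; others⊆Cs = λ inCs′ → there (Cs′⊆Cs inCs′)
      ; disjoint  = All.zipWith {P = VertexDisjoint C′} {Q = VertexDisjoint D} (λ {E} → spliced-apart {E})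
                      (C′-apart , D-apart′) ∷ disjointCs′
      ; count     = λ e → trans (cong (_+ usesAll e Cs′) (Splice.count S e))
                                (trans (+-assoc (uses e (steps C′)) _ _) (count-next e))
      }
      where
      S : Splice C′ D
      S = splice C′ D visitC′ visitD
      spliced-apart : ∀ {E} → VertexDisjoint C′ E × VertexDisjoint D E → VertexDisjoint (Splice.circuit S) E
      spliced-apart (C′-E , D-E) visit visitE with Splice.visits S visit
      ... | inj₁ visitC′ = C′-E visitC′ visitE
      ... | inj₂ visitD = D-E visitD visitE
    extend (inj₂ apart) = record
      { circuit   = C′
      ; others    = D ∷ Cs′
      ; others⊆Cs = λ { (here D≡) → here D≡ ; (there inCs′) → there (Cs′⊆Cs inCs′) }
      ; disjoint  = (apart ∷ C′-apart) ∷ D-apart′ ∷ disjointCs′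
      ; count     = count-next
      }

  -- Splice C with every member of the family it meets; the members it misses stay disjoint from it.
  absorb : ∀ C Cs → AllPairs VertexDisjoint Cs → Absorption C Cs
  absorb C [] [] =
    record { circuit = C ; others = [] ; others⊆Cs = λ () ; disjoint = [] ∷ [] ; count = λ _ → refl }
  absorb C (D ∷ Cs) (D-apart ∷ disjointCs) = absorb-next D-apart (absorb C Cs disjointCs)

  degreeIn : Subset nE → Fin nV → ℕ
  degreeIn R v = ∑[ e < nE ] (⟦ lookup R e ⟧ * ends e v)

  degreeIn-remove : ∀ {R e} → e ∈ R → ∀ v → degreeIn R v ≡ degreeIn (R - e) v + ends e v
  degreeIn-remove {R} {e} e∈R v = begin
    degreeIn R v
      ≡⟨ sum-cong-≗ (λ e′ → cong (_* ends e′ v) (⟦∈⟧-remove e∈R e′)) ⟩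
    ∑[ e′ < nE ] ((in-rest e′ + δ e e′) * ends e′ v)
      ≡⟨ sum-cong-≗ (λ e′ → *-distribʳ-+ (ends e′ v) (in-rest e′) (δ e e′)) ⟩
    ∑[ e′ < nE ] (in-rest e′ * ends e′ v + δ e e′ * ends e′ v)
      ≡⟨ ∑-distrib-+ (λ e′ → in-rest e′ * ends e′ v) _ ⟩
    degreeIn (R - e) v + ∑[ e′ < nE ] (δ e e′ * ends e′ v)
      ≡⟨ cong (degreeIn (R - e) v +_) (∑-δ* e (λ e′ → ends e′ v)) ⟩
    degreeIn (R - e) v + ends e v
      ∎
    where
    open ≡-Reasoning
    in-rest : Fin nE → ℕ
    in-rest e′ = ⟦ lookup (R - e) e′ ⟧

  leave : ∀ {R x} → 0 < degreeIn R x → ∃ λ e → e ∈ R × ∃ λ y → Step x e y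
  leave {R} {x} 0<degree =
    let e , 0<term = ∑-positive (λ e → ⟦ lookup R e ⟧ * ends e x) 0<degree
        e∈R , 0<ends = 0<⟦∈⟧*⇒ {p = R} 0<term
    in e , e∈R , step-from e (Equivalence.to 0<δ+δ⇔ 0<ends)

  odd-step : ∀ {R e x y u} → e ∈ R → Step x e y →
    ∀ v → 2 ∣ degreeIn R v + (δ x v + δ u v) → 2 ∣ degreeIn (R - e) v + (δ y v + δ u v)
  odd-step {R} {e} {x} {y} {u} e∈R step v 2∣ = ∣m+n∣n⇒∣m (subst (2 ∣_) (begin
    degreeIn R v + (δ x v + δ u v)
      ≡⟨ cong (_+ (δ x v + δ u v)) (degreeIn-remove e∈R v) ⟩
    degreeIn (R - e) v + ends e v + (δ x v + δ u v)
      ≡⟨ cong (λ k → degreeIn (R - e) v + k + (δ x v + δ u v)) (step-ends step v) ⟩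
    degreeIn (R - e) v + (δ x v + δ y v) + (δ x v + δ u v)
      ≡⟨ reorder (degreeIn (R - e) v) (δ x v) (δ y v) (δ u v) ⟩
    degreeIn (R - e) v + (δ y v + δ u v) + (δ x v + δ x v)
      ∎) 2∣) (2∣m+m (δ x v))
    where
    open ≡-Reasoning
    reorder : ∀ d a b c → d + (a + b) + (a + c) ≡ d + (b + c) + (a + a)
    reorder = solve-∀

  count-remove : ∀ {R e} → e ∈ R → ∀ {k : Fin nE → ℕ} → (∀ e′ → ⟦ lookup (R - e) e′ ⟧ ≡ k e′) →
    ∀ e′ → ⟦ lookup R e′ ⟧ ≡ δ e e′ + k e′
  count-remove {R} {e} e∈R {k} count e′ =
    trans (⟦∈⟧-remove e∈R e′) (trans (cong (_+ δ e e′) (count e′)) (+-comm (k e′) (δ e e′)))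

  _⊏_ : Subset nE → Subset nE → Set
  R ⊏ R′ = ∣ R ∣ < ∣ R′ ∣

  ⊏-wellFounded : WellFounded _⊏_
  ⊏-wellFounded = On.wellFounded ∣_∣ <-wellFounded

  record TrailIn (R : Subset nE) (x u : Fin nV) : Set where
    field
      steps  : Steps
      walk   : Walk x steps u
      rest   : Subset nE
      rest⊆R : rest ⊆ R
      count  : ∀ e → ⟦ lookup R e ⟧ ≡ uses e steps + ⟦ lookup rest e ⟧
      even   : ∀ v → 2 ∣ degreeIn rest v

  -- The odd vertices of R are x and u (none if x ≡ u), so until the walk reaches u
  -- some edge of R is left at x, and crossing it moves the odd vertex x to its other end.
  trailTo : ∀ R → Acc _⊏_ R → ∀ x u → (∀ v → 2 ∣ degreeIn R v + (δ x v + δ u v)) → TrailIn R x u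
  trailTo R (acc rec) x u odd with x ≟ u
  ... | yes refl = record
    { steps = [] ; walk = [] ; rest = R ; rest⊆R = id ; count = λ _ → refl
    ; even  = λ v → ∣m+n∣n⇒∣m (odd v) (2∣m+m (δ x v))
    }
  ... | no x≢u = record
    { steps  = (e , y) ∷ TrailIn.steps trail
    ; walk   = step ∷ TrailIn.walk trail
    ; rest   = TrailIn.rest trail
    ; rest⊆R = p─q⊆p R ⁅ e ⁆ ∘ TrailIn.rest⊆R trail
    ; count  = λ e′ → trans (count-remove {R} e∈R (TrailIn.count trail) e′) (sym (+-assoc (δ e e′) _ _))
    ; even   = TrailIn.even trail
    }
    where
    2∣degree+1 : 2 ∣ degreeIn R x + 1
    2∣degree+1 = subst (2 ∣_) (cong₂ (λ a b → degreeIn R x + (a + b)) (δ-refl x) (δ-≢ (x≢u ∘ sym)))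
                       (odd x)
    exit : ∃ λ e → e ∈ R × ∃ λ y → Step x e y
    exit = leave (2∣n+1⇒0<n 2∣degree+1)
    e : Fin nE
    e = proj₁ exit
    e∈R : e ∈ R
    e∈R = proj₁ (proj₂ exit)
    y : Fin nV
    y = proj₁ (proj₂ (proj₂ exit))
    step : Step x e y
    step = proj₂ (proj₂ (proj₂ exit))
    trail : TrailIn (R - e) y u
    trail = trailTo (R - e) (rec (x∈p⇒∣p-x∣<∣p∣ e∈R)) y u λ v → odd-step {R} {u = u} e∈R step v (odd v)

  record Decomposition (R : Subset nE) : Set where
    field
      circuits : List Circuit
      disjoint : AllPairs VertexDisjoint circuits
      count    : ∀ e → ⟦ lookup R e ⟧ ≡ usesAll e circuits

  -- Close a circuit through some edge e of R, decompose the rest and absorb the circuit into it.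
  decompose : ∀ R → Acc _⊏_ R → (∀ v → 2 ∣ degreeIn R v) → Decomposition R
  decompose R (acc rec) even with nonempty? R
  ... | no empty =
    record { circuits = [] ; disjoint = [] ; count = λ e → ⟦∉⟧≡0 λ e∈R → empty (e , e∈R) }
  ... | yes (e , e∈R) = record
    { circuits = Absorption.circuit A ∷ Absorption.others A
    ; disjoint = Absorption.disjoint A
    ; count    = λ e′ → begin
        ⟦ lookup R e′ ⟧
          ≡⟨ count-remove {R} e∈R count e′ ⟩
        δ e e′ + (uses e′ trailSteps + ⟦ lookup rest e′ ⟧)
          ≡⟨ cong (λ k → δ e e′ + (uses e′ trailSteps + k)) (Decomposition.count D e′) ⟩
        δ e e′ + (uses e′ trailSteps + usesAll e′ (circuits D))
          ≡⟨ +-assoc (δ e e′) _ _ ⟨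
        uses e′ (steps C) + usesAll e′ (circuits D)
          ≡⟨ Absorption.count A e′ ⟨
        usesAll e′ (Absorption.circuit A ∷ Absorption.others A)
          ∎
    }
    where
    open ≡-Reasoning
    open Decomposition using (circuits)
    trail : TrailIn (R - e) (tgt e) (src e)
    trail = trailTo (R - e) (rec (x∈p⇒∣p-x∣<∣p∣ e∈R)) (tgt e) (src e) λ v →
      subst (2 ∣_) (trans (degreeIn-remove e∈R v) (cong (degreeIn (R - e) v +_) (+-comm (δ (src e) v) _)))
                   (even v)
    open TrailIn trail using (rest; rest⊆R; count) renaming (steps to trailSteps; walk to trailWalk)
    C : Circuit
    C = record
      { start = src e
      ; steps = (e , tgt e) ∷ trailSteps
      ; walk  = inj₁ (refl , refl) ∷ trailWalk
      ; long  = s≤s (walk-nonempty trailWalk (src≢tgt e ∘ sym))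
      }
    D : Decomposition rest
    D = decompose rest (rec (≤-<-trans (p⊆q⇒∣p∣≤∣q∣ rest⊆R) (x∈p⇒∣p-x∣<∣p∣ e∈R))) (TrailIn.even trail)
    A : Absorption C (circuits D)
    A = absorb C (circuits D) (Decomposition.disjoint D)

  anchorOf : Fin nV → (ps : Steps) → Fin (suc (length ps)) → Fin nV
  anchorOf x ps zero = x
  anchorOf x ((_ , y) ∷ ps) (suc i) = anchorOf y ps i

  edgeAt : (ps : Steps) → Fin (length ps) → Fin nE
  edgeAt ps i = proj₁ (List.lookup ps i)

  walk-step : ∀ {x ps y} → Walk x ps y →
    ∀ i → Step (anchorOf x ps (inject₁ i)) (edgeAt ps i) (anchorOf x ps (suc i))
  walk-step (s ∷ _) zero = s
  walk-step (_ ∷ w) (suc i) = walk-step w i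

  walk-end : ∀ {x ps y} → Walk x ps y → anchorOf x ps (fromℕ (length ps)) ≡ y
  walk-end [] = refl
  walk-end (_ ∷ w) = walk-end w

  anchor-visited : ∀ x ps (i : Fin (length ps)) → Visits ps (anchorOf x ps (suc i))
  anchor-visited x (_ ∷ ps) zero = here refl
  anchor-visited x ((_ , y) ∷ ps) (suc i) = there (anchor-visited y ps i)

  closed-anchor-visited : ∀ {x ps} → Walk x ps x → 0 < length ps → ∀ k → Visits ps (anchorOf x ps k)
  closed-anchor-visited {x} {ps@(_ ∷ _)} w _ zero = subst (Visits ps) (walk-end w) (anchor-visited x ps (fromℕ _))
  closed-anchor-visited {x} {ps} w _ (suc i) = anchor-visited x ps i

  uses≡∑ : ∀ e ps → uses e ps ≡ ∑[ i < length ps ] δ (edgeAt ps i) e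
  uses≡∑ e ps = sum-map≡∑-lookup (λ (e′ , _) → δ e′ e) ps

  0<uses⇔traversed : ∀ {e} ps → 0 < uses e ps ⇔ ∃ λ i → edgeAt ps i ≡ e
  0<uses⇔traversed {e} ps = mk⇔
    (λ 0<uses → let i , 0<δ = ∑-positive _ (subst (0 <_) (uses≡∑ e ps) 0<uses) in i , δ-positive 0<δ)
    (λ { (i , refl) →
          subst (0 <_) (sym (uses≡∑ e ps)) (≤-trans (≤-reflexive (sym (δ-refl e))) (∑-≤ _ i)) })

  uses≤1⇒injective : ∀ ps → (∀ e → uses e ps ≤ 1) → ∀ i j → edgeAt ps i ≡ edgeAt ps j → i ≡ j
  uses≤1⇒injective ps once i j edge≡ =
    ∑≤1⇒unique _ (subst (_≤ 1) (uses≡∑ e ps) (once e))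
      (≤-reflexive (sym (δ-refl e)))
      (≤-reflexive (sym (trans (cong (λ e′ → δ e′ e) (sym edge≡)) (δ-refl e))))
    where
    e : Fin nE
    e = edgeAt ps i

  toTrail : (C : Circuit) → (∀ e → uses e (steps C) ≤ 1) → ClosedStrictTrail H
  toTrail C once = record
    { len      = length (steps C)
    ; anchor   = anchorOf (start C) (steps C)
    ; edge     = edgeAt (steps C)
    ; len≥2    = long C
    ; distinct = step-distinct ∘ walk-step (walk C)
    ; inEdge   = step-∈ ∘ walk-step (walk C)
    ; closed   = sym (walk-end (walk C))
    ; strict   = uses≤1⇒injective (steps C) once
    }

  module _ (even : ∀ v → 2 ∣ fibreSize src v + fibreSize tgt v) where

    ⟦∈⊤⟧ : ∀ e → ⟦ lookup (⊤ {nE}) e ⟧ ≡ 1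
    ⟦∈⊤⟧ e = cong ⟦_⟧ (lookup-replicate e true)

    degreeIn-⊤ : ∀ v → degreeIn ⊤ v ≡ fibreSize src v + fibreSize tgt v
    degreeIn-⊤ v = begin
      degreeIn ⊤ v
        ≡⟨ sum-cong-≗ (λ e → trans (cong (_* ends e v) (⟦∈⊤⟧ e)) (*-identityˡ (ends e v))) ⟩
      ∑[ e < nE ] ends e v
        ≡⟨ ∑-distrib-+ (λ e → δ (src e) v) (λ e → δ (tgt e) v) ⟩
      fibreSize src v + fibreSize tgt v
        ∎
      where open ≡-Reasoning

    open Decomposition (decompose ⊤ (⊏-wellFounded ⊤) (λ v → subst (2 ∣_) (sym (degreeIn-⊤ v)) (even v)))

    usesAll≡1 : ∀ e → ∑[ t < length circuits ] uses e (steps (List.lookup circuits t)) ≡ 1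
    usesAll≡1 e =
      trans (sym (sum-map≡∑-lookup (uses e ∘ steps) circuits)) (trans (sym (count e)) (⟦∈⊤⟧ e))

    trail : Fin (length circuits) → ClosedStrictTrail H
    trail t = toTrail (List.lookup circuits t) λ e →
      ≤-trans (∑-≤ (λ t′ → uses e (steps (List.lookup circuits t′))) t) (≤-reflexive (usesAll≡1 e))

    eulerFamily : EulerFamily H
    eulerFamily = record
      { size     = length circuits
      ; trail    = trail
      ; disjoint = λ s t s≢t i j anchor≡ →
          AllPairs-lookup {R = VertexDisjoint} (λ apart visit visit′ → apart visit′ visit) disjoint s≢t
            (closed-anchor-visited (walk (List.lookup circuits s)) (nonempty s) i)
            (subst (Visits _) (sym anchor≡) (closed-anchor-visited (walk (List.lookup circuits t)) (nonempty t) j))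
      ; cover    = λ e → ∃!-map (λ {t} → 0<uses⇔traversed (steps (List.lookup circuits t)))
                                (∑≡1⇒∃! (λ t → uses e (steps (List.lookup circuits t))) (usesAll≡1 e))
      }
      where
      nonempty : ∀ t → 0 < length (steps (List.lookup circuits t))
      nonempty t = ≤-trans (s≤s z≤n) (long (List.lookup circuits t))

QuasiEulerian⇔EvenTraversal : ∀ {H} → QuasiEulerian H ⇔ EvenTraversal H
QuasiEulerian⇔EvenTraversal =
  mk⇔ EulerFamily⇒EvenTraversal λ (T , even) → EulerDecomposition.eulerFamily T even

mainTheorem17 : (H : Hypergraph) → 1 ≤ Hypergraph.nV H →
    ThreeUniform H → EvenDegrees H →
    (QuasiEulerian H → EvenOneSubgraph H) × (EvenOneSubgraph H → QuasiEulerian H) ×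
    (QuasiEulerian H → IntersectingPairPartition H) × (IntersectingPairPartition H → QuasiEulerian H)
mainTheorem17 H _ uniform even =
  from EvenOneSubgraph⇔EvenChoice ∘ toChoice ,
  fromChoice ∘ to EvenOneSubgraph⇔EvenChoice ,
  from IntersectingPairPartition⇔EvenChoice ∘ toChoice ,
  fromChoice ∘ to IntersectingPairPartition⇔EvenChoice
  where
  open Equivalence
  toChoice : QuasiEulerian H → EvenChoice H
  toChoice = to (EvenTraversal⇔EvenChoice uniform even) ∘ to QuasiEulerian⇔EvenTraversal
  fromChoice : EvenChoice H → QuasiEulerian H
  fromChoice = from QuasiEulerian⇔EvenTraversal ∘ from (EvenTraversal⇔EvenChoice uniform even)
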